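{- Let $D$ be a finite set, $r\in\mathbb{N}$, and let $P\subseteq Q\subseteq R\subseteq D^r$ be predicates. Then for all $n$, \[ \operatorname{NRD}(P\mid Q,n)\le\operatorname{NRD}(P\mid R,n)\le\operatorname{NRD}(P\mid Q,n)+\operatorname{NRD}(Q\mid R,n). \] In particular (taking $R=D^r$), $\operatorname{NRD}(P\mid Q,n)\le\operatorname{NRD}(P,n)\le\operatorname{NRD}(P\mid Q,n)+\operatorname{NRD}(Q,n)$.
   Context: An instance $(X,Y)$ of $\operatorname{CSP}(P)$ has a finite variable set $X$ and clauses $Y\subseteq X^r$; for $\sigma:X\to D$, $\sigma(y)=(\sigma(y_1),\dots,\sigma(y_r))$. For $P\subseteq Q\subseteq D^r$, the instance is $Q$-conditionally non-redundant if for each $y\in Y$ there is $\sigma_y:X\to D$ with $\sigma_y(y)\in Q\setminus P$ and $\sigma_y(y')\in P$ for all $y'\in Y\setminus\{y\}$. $\operatorname{NRD}(P\mid Q,n)$ is the maximum $|Y|$ of a $Q$-conditionally non-redundant instance of $\operatorname{CSP}(P)$ with $n$ variables, and $\operatorname{NRD}(P,n):=\operatorname{NRD}(P\mid D^r,n)$ (the maximum size of a non-redundant instance). -}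

module Defs where

open import Data.Nat using (ℕ; _≤_)
open import Data.Fin using (Fin)
open import Data.Vec using (Vec; map)
open import Data.List using (List; length)
open import Data.List.Membership.Propositional using (_∈_)
open import Data.List.Relation.Unary.Unique.Propositional using (Unique)
open import Data.Product using (Σ; _×_; ∃)
open import Relation.Unary using (Pred; _⊆_)
open import Relation.Binary.PropositionalEquality using (_≡_)
open import Relation.Nullary using (¬_)
open import Level using (0ℓ)

-- The domain D is Fin d (an arbitrary finite set), tuples in D^r are Vec (Fin d) r.
-- A predicate of arity r on D is a subset of D^r.
Predicate : ℕ → ℕ → Set₁
Predicate d r = Pred (Vec (Fin d) r) 0ℓ

-- An instance with variable set X = Fin n: a finite *set* Y ⊆ X^r of clauses,
-- represented as a duplicate-free list.
record Instance (n r : ℕ) : Set where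
  constructor mkInstance
  field
    clauses : List (Vec (Fin n) r)
    unique  : Unique clauses
open Instance public

size : ∀ {n r} → Instance n r → ℕ
size I = length (clauses I)

apply : ∀ {n d r} → (Fin n → Fin d) → Vec (Fin n) r → Vec (Fin d) r
apply σ y = map σ y

CondNonRedundant : ∀ {d r n} → Predicate d r → Predicate d r → Instance n r → Set
CondNonRedundant {d} {r} {n} P Q I =
  ∀ y → y ∈ clauses I →
    Σ (Fin n → Fin d) λ σ →
      (Q (apply σ y) × ¬ P (apply σ y)) ×
      (∀ y′ → y′ ∈ clauses I → ¬ y′ ≡ y → P (apply σ y′))

IsNRD : ∀ {d r} → Predicate d r → Predicate d r → ℕ → ℕ → Set
IsNRD {d} {r} P Q n m =
  (Σ (Instance n r) λ I → CondNonRedundant P Q I × size I ≡ m) ×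
  (∀ (I : Instance n r) → CondNonRedundant P Q I → size I ≤ m)

-- Sort the clauses of a (P | R)-non-redundant instance by whether some
-- assignment witnessing their non-redundancy sends them into Q.  The clauses
-- sent into Q form a (P | Q)-non-redundant instance; the others, since P ⊆ Q,
-- a (Q | R)-non-redundant one.  Membership in Q is not decidable, so the sorting
-- exists only under double negation, which suffices because the goal, an
-- inequality of naturals, is decidable.
{-# OPTIONS --safe #-}
module Submission where

open import Defs
open import Level using (Level)
open import Data.Nat using (ℕ; _≤_; _+_; suc)
open import Data.Nat.Properties using (_≤?_; +-mono-≤; +-suc; ≤-reflexive; ≤-trans)
open import Data.Fin using (Fin)
open import Data.Vec using (Vec)
open import Data.List using (List; []; _∷_; length)
open import Data.List.Membership.Propositional using (_∈_)
open import Data.List.Relation.Unary.All as All using (All; []; _∷_)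
open import Data.List.Relation.Unary.AllPairs using (AllPairs; []; _∷_)
open import Data.List.Relation.Binary.Sublist.Propositional using ([]; _∷_; _∷ʳ_)
  renaming (_⊆_ to _⊑_)
open import Data.List.Relation.Binary.Sublist.Propositional.Properties using (All-resp-⊆; Any-resp-⊆)
open import Data.Product using (Σ; _×_; _,_)
open import Function using (_∘_)
open import Relation.Binary.Core using (Rel)
open import Relation.Binary.PropositionalEquality using (_≡_; refl; sym; trans; cong)
open import Relation.Nullary using (¬_; Dec; yes; no)
open import Relation.Nullary.Decidable using (decidable-stable; ¬¬-excluded-middle)
open import Relation.Nullary.Negation using (¬¬-map)
open import Relation.Unary using (Pred; _⊆_; ∁)

private
  variable
    a ℓ : Level
    A : Set a
    d r n : ℕ

AllPairs-resp-⊑ : {R : Rel A ℓ} {xs ys : List A} → ys ⊑ xs → AllPairs R xs → AllPairs R ys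
AllPairs-resp-⊑ []         []         = []
AllPairs-resp-⊑ (_ ∷ʳ ys⊑) (_ ∷ xs)   = AllPairs-resp-⊑ ys⊑ xs
AllPairs-resp-⊑ (refl ∷ ys⊑) (x ∷ xs) = All-resp-⊆ ys⊑ x ∷ AllPairs-resp-⊑ ys⊑ xs

¬¬-decideAll : (B : Pred A ℓ) (xs : List A) → ¬ ¬ All (Dec ∘ B) xs
¬¬-decideAll B []       k = k []
¬¬-decideAll B (x ∷ xs) k =
  ¬¬-excluded-middle λ decision → ¬¬-decideAll B xs λ decisions → k (decision ∷ decisions)

record Partition {A : Set a} (B : Pred A ℓ) (xs : List A) : Set (a Level.⊔ ℓ) where
  field
    accepted rejected : List A
    accepted⊑        : accepted ⊑ xs
    rejected⊑        : rejected ⊑ xs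
    all-accepted     : All B accepted
    all-rejected     : All (∁ B) rejected
    length-partition : length xs ≡ length accepted + length rejected

module _ {B : Pred A ℓ} where

  partition : {xs : List A} → All (Dec ∘ B) xs → Partition B xs
  partition [] = record
    { accepted = [] ; rejected = [] ; accepted⊑ = [] ; rejected⊑ = []
    ; all-accepted = [] ; all-rejected = [] ; length-partition = refl }
  partition {xs = x ∷ _} (yes b ∷ decisions) = record
    { accepted = x ∷ accepted ; rejected = rejected
    ; accepted⊑ = refl ∷ accepted⊑ ; rejected⊑ = x ∷ʳ rejected⊑
    ; all-accepted = b ∷ all-accepted ; all-rejected = all-rejected
    ; length-partition = cong suc length-partition }
    where open Partition (partition decisions)
  partition {xs = x ∷ _} (no ¬b ∷ decisions) = record
    { accepted = accepted ; rejected = x ∷ rejected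
    ; accepted⊑ = x ∷ʳ accepted⊑ ; rejected⊑ = refl ∷ rejected⊑
    ; all-accepted = all-accepted ; all-rejected = ¬b ∷ all-rejected
    ; length-partition = trans (cong suc length-partition)
                               (sym (+-suc (length accepted) (length rejected))) }
    where open Partition (partition decisions)

  ¬¬-partition : (xs : List A) → ¬ ¬ Partition B xs
  ¬¬-partition xs = ¬¬-map partition (¬¬-decideAll B xs)

IsWitness : Predicate d r → Predicate d r → Instance n r → Vec (Fin n) r → (Fin n → Fin d) → Set
IsWitness P Q I y σ =
  (Q (apply σ y) × ¬ P (apply σ y)) × (∀ y′ → y′ ∈ clauses I → ¬ y′ ≡ y → P (apply σ y′))

restrict : (I : Instance n r) {ys : List (Vec (Fin n) r)} → ys ⊑ clauses I → Instance n r
restrict I {ys} ys⊑ = mkInstance ys (AllPairs-resp-⊑ ys⊑ (unique I))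

CondNonRedundant-monoʳ : {P Q R : Predicate d r} {I : Instance n r} →
                         Q ⊆ R → CondNonRedundant P Q I → CondNonRedundant P R I
CondNonRedundant-monoʳ Q⊆R nr y y∈I with nr y y∈I
... | σ , (inQ , ¬p) , elsewhere = σ , (Q⊆R inQ , ¬p) , elsewhere

record Decomposition (P Q R : Predicate d r) (I : Instance n r) : Set where
  field
    lower upper         : Instance n r
    lower-nonRedundant  : CondNonRedundant P Q lower
    upper-nonRedundant  : CondNonRedundant Q R upper
    size-decomposition  : size I ≡ size lower + size upper

module _ {P Q R : Predicate d r} (P⊆Q : P ⊆ Q) {I : Instance n r} (nr : CondNonRedundant P R I) where

  LowerWitnessed : Pred (Vec (Fin n) r) _
  LowerWitnessed y = Σ (Fin n → Fin d) λ σ → Q (apply σ y) × IsWitness P R I y σ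

  decompose : Partition LowerWitnessed (clauses I) → Decomposition P Q R I
  decompose parts = record
    { lower = restrict I accepted⊑
    ; upper = restrict I rejected⊑
    ; lower-nonRedundant = lower-nonRedundant
    ; upper-nonRedundant = upper-nonRedundant
    ; size-decomposition = length-partition }
    where
    open Partition parts

    lower-nonRedundant : CondNonRedundant P Q (restrict I accepted⊑)
    lower-nonRedundant y y∈ with All.lookup all-accepted y∈
    ... | σ , inQ , (_ , ¬p) , elsewhere =
      σ , (inQ , ¬p) , λ y′ y′∈ → elsewhere y′ (Any-resp-⊆ accepted⊑ y′∈)

    upper-nonRedundant : CondNonRedundant Q R (restrict I rejected⊑)
    upper-nonRedundant y y∈ with nr y (Any-resp-⊆ rejected⊑ y∈)
    ... | σ , witness@((inR , _) , elsewhere) =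
      σ , (inR , ¬q) , λ y′ y′∈ y′≢y → P⊆Q (elsewhere y′ (Any-resp-⊆ rejected⊑ y′∈) y′≢y)
      where
      ¬q : ¬ Q (apply σ y)
      ¬q inQ = All.lookup all-rejected y∈ (σ , inQ , witness)

  ¬¬-decomposition : ¬ ¬ Decomposition P Q R I
  ¬¬-decomposition = ¬¬-map decompose (¬¬-partition (clauses I))

proposition6p3 : (d r : ℕ) (P Q R : Predicate d r) → P ⊆ Q → Q ⊆ R →
    (n a b c : ℕ) → IsNRD P Q n a → IsNRD P R n b → IsNRD Q R n c →
    a ≤ b × b ≤ a + c
proposition6p3 d r P Q R P⊆Q Q⊆R n a b c
  ((Ia , nrIa , refl) , a-max) ((Ib , nrIb , refl) , b-max) (_ , c-max) =
  b-max Ia (CondNonRedundant-monoʳ {P = P} {Q} {R} {Ia} Q⊆R nrIa) ,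
  decidable-stable (size Ib ≤? size Ia + c) (¬¬-map bound (¬¬-decomposition {R = R} P⊆Q nrIb))
  where
  bound : Decomposition P Q R Ib → size Ib ≤ size Ia + c
  bound parts = ≤-trans (≤-reflexive size-decomposition)
                        (+-mono-≤ (a-max lower lower-nonRedundant) (c-max upper upper-nonRedundant))
    where open Decomposition parts
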